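{- Let $k\ge 2$, let $\Sigma=\{\sigma_0,\dots,\sigma_{k-1}\}$ be a finite alphabet with $\sigma_j$ having symbol code $j$, and let $\beta=k+1$. Define $\ulcorner\cdot\urcorner:\Sigma^*\to\mathbb{N}$ by $\ulcorner\varepsilon\urcorner=0$ for the empty string and, for a nonempty string $s=s_1\cdots s_m$ with symbol codes $c_1,\dots,c_m$, \[\ulcorner s\urcorner=\sum_{i=0}^{m-1}F_{2+i\beta+c_{i+1}}.\] Then $\ulcorner\cdot\urcorner$ is injective on $\Sigma^*$: if $s\neq t$ then $\ulcorner s\urcorner\neq\ulcorner t\urcorner$.
   Context: $F_n$ denotes the Fibonacci sequence with $F_0=0$, $F_1=1$, $F_{n+2}=F_{n+1}+F_n$. -}

module Defs where

open import Data.Nat using (ℕ; zero; suc; _+_; _*_)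
open import Data.Fin using (Fin; toℕ)
open import Data.List using (List; []; _∷_)

fib : ℕ → ℕ
fib zero = 0
fib (suc zero) = 1
fib (suc (suc n)) = fib (suc n) + fib n

-- The alphabet Σ = {σ_0,…,σ_{k-1}} is Fin k; σ_j has symbol code toℕ j.
-- Strings over Σ are List (Fin k); ε = [].

codeFrom : (k : ℕ) → ℕ → List (Fin k) → ℕ
codeFrom k i [] = 0
codeFrom k i (c ∷ s) = fib (2 + i * suc k + toℕ c) + codeFrom k (suc i) s

code : (k : ℕ) → List (Fin k) → ℕ
code k s = codeFrom k 0 s

{-# OPTIONS --safe #-}

-- Consecutive letters contribute Fibonacci indices differing by β + c' − c ≥ 2, so, as in
-- Zeckendorf's theorem, a string whose last letter contributes F n has code in [F n, F (n+1)).
-- Hence the code determines n; removing the term F n and recursing recovers the prefix,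
-- after which n also determines the last letter.

module Submission where

open import Defs
open import Data.Nat using (ℕ; _≥_; zero; suc; _+_; _*_; _≤_; _<_; z≤n; s≤s)
open import Data.Nat.Properties
open import Data.Fin using (Fin; toℕ)
open import Data.Fin.Properties using (toℕ-injective; toℕ<n)
open import Data.List using (List; []; _∷_; _∷ʳ_; length)
open import Data.List.Properties using (length-++)
open import Data.List.Reverse using (Reverse; []; _∶_∶ʳ_; reverseView)
open import Relation.Binary.Definitions using (tri<; tri≈; tri>)
open import Relation.Binary.PropositionalEquality
open import Relation.Nullary using (contradiction)

fib-positive : ∀ n → 1 ≤ fib (suc n)
fib-positive zero = s≤s z≤n
fib-positive (suc n) = ≤-trans (fib-positive n) (m≤m+n _ _)

fib-mono : ∀ {m n} → m ≤ n → fib m ≤ fib n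
fib-mono z≤n = z≤n
fib-mono {n = suc n} (s≤s z≤n) = fib-positive n
fib-mono (s≤s (s≤s m≤n)) = +-mono-≤ (fib-mono (s≤s m≤n)) (fib-mono m≤n)

fib-interval-unique : ∀ {m n a} → fib m ≤ a → a < fib (suc m) →
                      fib n ≤ a → a < fib (suc n) → m ≡ n
fib-interval-unique {m} {n} Fm≤a a<Fm+1 Fn≤a a<Fn+1 with <-cmp m n
... | tri< m<n _ _ = contradiction (≤-trans (fib-mono m<n) Fn≤a) (<⇒≱ a<Fm+1)
... | tri≈ _ m≡n _ = m≡n
... | tri> _ _ n<m = contradiction (≤-trans (fib-mono n<m) Fm≤a) (<⇒≱ a<Fn+1)

module _ (k : ℕ) where

  lastIndex : List (Fin k) → Fin k → ℕ
  lastIndex s c = 2 + length s * suc k + toℕ c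

  codeFrom-∷ʳ : ∀ i s c →
                codeFrom k i (s ∷ʳ c) ≡ codeFrom k i s + fib (2 + (i + length s) * suc k + toℕ c)
  codeFrom-∷ʳ i [] c rewrite +-identityʳ i = +-identityʳ _
  codeFrom-∷ʳ i (x ∷ s) c rewrite codeFrom-∷ʳ (suc i) s c | +-suc i (length s) =
    sym (+-assoc (fib (2 + i * suc k + toℕ x)) _ _)

  code-∷ʳ : ∀ s c → code k (s ∷ʳ c) ≡ code k s + fib (lastIndex s c)
  code-∷ʳ = codeFrom-∷ʳ 0

  fib≤code-∷ʳ : ∀ s c → fib (lastIndex s c) ≤ code k (s ∷ʳ c)
  fib≤code-∷ʳ s c rewrite code-∷ʳ s c = m≤n+m _ (code k s)

  code-∷ʳ>0 : ∀ s c → 0 < code k (s ∷ʳ c)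
  code-∷ʳ>0 s c = ≤-trans (fib-positive (1 + length s * suc k + toℕ c)) (fib≤code-∷ʳ s c)

  code<fib : ∀ {s} → Reverse s → code k s < fib (1 + length s * suc k)

  code-∷ʳ<fib : ∀ {s} → Reverse s → ∀ c → code k (s ∷ʳ c) < fib (suc (lastIndex s c))
  code-∷ʳ<fib {s} rs c rewrite code-∷ʳ s c = begin-strict
    code k s + fib (suc n)  <⟨ +-monoˡ-< (fib (suc n)) code<fib[n] ⟩
    fib n + fib (suc n)     ≡⟨ +-comm (fib n) _ ⟩
    fib (suc (suc n))       ∎
    where
    open ≤-Reasoning
    n = 1 + length s * suc k + toℕ c
    code<fib[n] : code k s < fib n
    code<fib[n] = <-≤-trans (code<fib rs) (fib-mono (s≤s (m≤m+n (length s * suc k) (toℕ c))))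

  code<fib [] = s≤s z≤n
  code<fib (s ∶ rs ∶ʳ c) = <-≤-trans (code-∷ʳ<fib rs c) (fib-mono lastIndex<)
    where
    open ≤-Reasoning
    lastIndex< : suc (lastIndex s c) ≤ 1 + length (s ∷ʳ c) * suc k
    lastIndex< = begin
      3 + length s * suc k + toℕ c       ≡⟨ cong suc (+-suc _ (toℕ c)) ⟨
      2 + length s * suc k + suc (toℕ c) ≤⟨ s≤s (s≤s (+-monoʳ-≤ _ (toℕ<n c))) ⟩
      2 + length s * suc k + k           ≡⟨ cong (2 +_) (+-comm (length s * suc k) k) ⟩
      1 + suc k + length s * suc k       ≡⟨ cong (λ n → 1 + n * suc k) (+-comm (length s) 1) ⟨
      1 + (length s + 1) * suc k         ≡⟨ cong (λ n → 1 + n * suc k) (length-++ s) ⟨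
      1 + length (s ∷ʳ c) * suc k        ∎

  code-∷ʳ-cancel : ∀ s t c d → lastIndex s c ≡ lastIndex t d →
                   code k (s ∷ʳ c) ≡ code k (t ∷ʳ d) → code k s ≡ code k t
  code-∷ʳ-cancel s t c d sameIndex eq = +-cancelʳ-≡ _ _ _ (begin
    code k s + fib (lastIndex s c) ≡⟨ code-∷ʳ s c ⟨
    code k (s ∷ʳ c)                ≡⟨ eq ⟩
    code k (t ∷ʳ d)                ≡⟨ code-∷ʳ t d ⟩
    code k t + fib (lastIndex t d) ≡⟨ cong (λ n → code k t + fib n) sameIndex ⟨
    code k t + fib (lastIndex s c) ∎)
    where open ≡-Reasoning

  code-injective : ∀ {s t} → Reverse s → Reverse t → code k s ≡ code k t → s ≡ t
  code-injective [] [] _ = refl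
  code-injective [] (t ∶ _ ∶ʳ d) eq =
    contradiction (sym eq) (>⇒≢ (code-∷ʳ>0 t d))
  code-injective (s ∶ _ ∶ʳ c) [] eq =
    contradiction eq (>⇒≢ (code-∷ʳ>0 s c))
  code-injective (s ∶ rs ∶ʳ c) (t ∶ rt ∶ʳ d) eq
    with sameIndex ← fib-interval-unique {lastIndex s c} {lastIndex t d}
                       (fib≤code-∷ʳ s c) (code-∷ʳ<fib rs c)
                       (subst (_ ≤_) (sym eq) (fib≤code-∷ʳ t d))
                       (subst (_< _) (sym eq) (code-∷ʳ<fib rt d))
    with refl ← code-injective rs rt (code-∷ʳ-cancel s t c d sameIndex eq)
    = cong (s ∷ʳ_) (toℕ-injective (+-cancelˡ-≡ (2 + length s * suc k) _ _ sameIndex))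

-- The hypothesis k ≥ 2 is not needed: the index gap β + c' − c ≥ 2 holds for every k.
theorem4p2 : (k : ℕ) → k ≥ 2 → (s t : List (Fin k)) → s ≢ t → code k s ≢ code k t
theorem4p2 k _ s t s≢t eq = s≢t (code-injective k (reverseView s) (reverseView t) eq)
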